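{- Let $K$ be a commutative semiring, $\sigma\in\{0,1\}$, and let $\mathcal G=(V,V_0,V_1,T,E)$ and $\mathcal G'=(V',V'_0,V'_1,T',E')$ be finite acyclic game graphs with basic valuations $f_\sigma:T\to K$, $h_\sigma:E\to K\setminus\{0\}$ and $f'_\sigma:T'\to K$, $h'_\sigma:E'\to K\setminus\{0\}$. Let $Z\subseteq V\times V'$ be a counting bisimulation between $\mathcal G$ and $\mathcal G'$ that respects these basic valuations. Then $f_\sigma(v)=f'_\sigma(v')$ for all $(v,v')\in Z$, where $f_\sigma:V\to K$ and $f'_\sigma:V'\to K$ are the induced $K$-valuations.
   Context: A game graph is $\mathcal G=(V,V_0,V_1,T,E)$ where $V$ is the disjoint union of $V_0$ (positions of Player 0), $V_1$ (positions of Player 1) and $T$ (terminal positions), $E\subseteq V\times V$, $vE=\{w:(v,w)\in E\}$, $vE=\emptyset$ iff $v\in T$. The induced valuation extends $f_\sigma$ by backward induction: $f_\sigma(v)=\sum_{w\in vE}h_\sigma(vw)f_\sigma(w)$ if $v\in V_\sigma$ and $f_\sigma(v)=\prod_{w\in vE}h_\sigma(vw)f_\sigma(w)$ if $v\in V_{1-\sigma}$ (similarly for $\mathcal G'$). A counting bisimulation is a relation $Z\subseteq V\times V'$ such that for every $(v,v')\in Z$: $v\in V_\rho$ iff $v'\in V'_\rho$ (for $\rho=0,1$), $v\in T$ iff $v'\in T'$, and there is a bijection $z_{vv'}:vE\to v'E'$ with $(w,z_{vv'}(w))\in Z$ for all $w\in vE$. $Z$ respects the basic valuations if $f_\sigma(t)=f'_\sigma(t')$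 for all $(t,t')\in Z\cap(T\times T')$, and $h_\sigma(vw)=h'_\sigma(v'w')$ whenever $(v,v')\in Z$, $(w,w')\in Z$, $(v,w)\in E$, $(v',w')\in E'$. Throughout, semirings are commutative with $0\ne1$, $+$-positive and root-integral. -}

module Defs where

open import Level using (Level; _⊔_; suc)
open import Data.Nat using (ℕ)
open import Data.Fin using (Fin)
open import Data.List using (List; []; map; foldr)
open import Data.List.Membership.Propositional using (_∈_)
open import Data.List.Relation.Unary.Unique.Propositional using (Unique)
open import Data.Product using (Σ; _×_; proj₁)
open import Relation.Binary.PropositionalEquality using (_≡_)
open import Relation.Binary.Construct.Closure.Transitive using (TransClosure)
open import Relation.Nullary using (¬_)
open import Function.Bundles using (_⤖_; Bijection)
open import Algebra.Bundles using (CommutativeSemiring)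

data Player : Set where
  P0 P1 : Player

opp : Player → Player
opp P0 = P1
opp P1 = P0

data Kind : Set where
  player   : Player → Kind
  terminal : Kind

-- A finite game graph: V = Fin size, partition V_0 / V_1 / T given by kind,
-- E given by duplicate-free successor lists (vE = the set of elements of succ v),
-- and vE = ∅ iff v ∈ T.
record GameGraph : Set where
  field
    size    : ℕ
    kind    : Fin size → Kind
    succ    : Fin size → List (Fin size)
    succ-unique : ∀ v → Unique (succ v)
    terminal-iff : ∀ v → (kind v ≡ terminal → succ v ≡ []) × (succ v ≡ [] → kind v ≡ terminal)

  V : Set
  V = Fin size

  Edge : V → V → Set
  Edge v w = w ∈ succ v

  vE : V → Set
  vE v = Σ V (Edge v)

open GameGraph public

Acyclic : GameGraph → Set
Acyclic G = ∀ v → ¬ TransClosure (Edge G) v v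

module _ {c ℓ} (K : CommutativeSemiring c ℓ) where
  open CommutativeSemiring K

  ΣK : List Carrier → Carrier
  ΣK = foldr _+_ 0#

  ΠK : List Carrier → Carrier
  ΠK = foldr _*_ 1#

  -- Basic valuations f_σ : T → K (values off T are irrelevant) and
  -- h_σ : E → K ∖ {0} (values off E are irrelevant).
  NonzeroOnEdges : (G : GameGraph) → (V G → V G → Carrier) → Set ℓ
  NonzeroOnEdges G h = ∀ v w → Edge G v w → ¬ (h v w ≈ 0#)

  IsInducedValuation : Player → (G : GameGraph) →
    (f : V G → Carrier) → (h : V G → V G → Carrier) → (F : V G → Carrier) → Set ℓ
  IsInducedValuation σ G f h F = ∀ v →
      (kind G v ≡ terminal → F v ≈ f v)
    × (kind G v ≡ player σ → F v ≈ ΣK (map (λ w → h v w * F w) (succ G v)))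
    × (kind G v ≡ player (opp σ) → F v ≈ ΠK (map (λ w → h v w * F w) (succ G v)))

  RespectsValuations : (G G' : GameGraph) → ∀ {z} → (V G → V G' → Set z) →
    (f : V G → Carrier) → (h : V G → V G → Carrier) →
    (f' : V G' → Carrier) → (h' : V G' → V G' → Carrier) → Set (ℓ ⊔ z)
  RespectsValuations G G' Z f h f' h' =
      (∀ t t' → Z t t' → kind G t ≡ terminal → kind G' t' ≡ terminal → f t ≈ f' t')
    × (∀ v v' w w' → Z v v' → Z w w' → Edge G v w → Edge G' v' w' → h v w ≈ h' v' w')

IsCountingBisimulation : (G G' : GameGraph) → ∀ {z} → (V G → V G' → Set z) → Set z
IsCountingBisimulation G G' Z = ∀ v v' → Z v v' →
    (∀ ρ → (kind G v ≡ player ρ → kind G' v' ≡ player ρ) × (kind G' v' ≡ player ρ → kind G v ≡ player ρ))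
  × (kind G v ≡ terminal → kind G' v' ≡ terminal) × (kind G' v' ≡ terminal → kind G v ≡ terminal)
  × Σ (vE G v ⤖ vE G' v') (λ zb → ∀ (w : vE G v) → Z (proj₁ w) (proj₁ (Bijection.to zb w)))

-- On a finite acyclic graph the successor relation is well-founded: a walk with as many
-- steps as there are positions revisits a position (pigeonhole), closing a cycle. By
-- well-founded induction, bisimilar positions have the same kind, and the bijection between
-- their successor sets pairs up summands (resp. factors) of equal value, so the two sums
-- (resp. products) agree because + and * are commutative and associative.
module Submission where

open import Defs
open import Algebra.Bundles using (CommutativeSemiring; CommutativeMonoid)
import Algebra.Properties.CommutativeMonoid.Sum as CommutativeMonoidSum
open import Data.Nat using (ℕ; zero; suc; _<_; _≤_; s≤s)
open import Data.Nat.Properties using (n<1+n; <⇒≤; m<1+n⇒m<n∨m≡n)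
open import Data.Fin using (Fin; toℕ) renaming (zero to fzero; suc to fsuc)
open import Data.Fin.Properties using (pigeonhole; toℕ≤pred[n])
open import Data.Fin.Permutation using (_⟨$⟩ʳ_)
open import Data.List using (List; []; _∷_; map; foldr; length; lookup)
open import Data.List.Relation.Unary.All as All using (All; []; _∷_)
open import Data.List.Relation.Unary.Any using (Any; here; there; index)
open import Data.List.Membership.Propositional using (_∈_; find)
open import Data.List.Membership.Propositional.Properties using (∈-lookup)
open import Data.Product using (Σ; _×_; _,_; proj₁; proj₂)
open import Data.Empty using (⊥-elim)
open import Data.Sum using (_⊎_; inj₁; inj₂)
open import Function using (flip; _∘′_)
open import Function.Bundles using (_⤖_; Bijection; _↔_; mk↔ₛ′)
open import Function.Properties.Bijection using (⤖⇒↔)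
open import Function.Construct.Composition using (_↔-∘_)
open import Function.Construct.Symmetry using (↔-sym)
open import Induction.WellFounded using (Acc; acc; WellFounded)
open import Relation.Binary.PropositionalEquality using (_≡_; refl; sym; cong; subst)
open import Relation.Binary.Construct.Closure.Transitive using (TransClosure; [_]; _∷ʳ_)
open import Relation.Nullary using (¬_)

module _ {a} {A : Set a} where

  index-∈-lookup : (xs : List A) (i : Fin (length xs)) → index (∈-lookup {xs = xs} i) ≡ i
  index-∈-lookup (x ∷ xs) fzero    = refl
  index-∈-lookup (x ∷ xs) (fsuc i) = cong fsuc (index-∈-lookup xs i)

  ∈-lookup-index : ∀ {xs : List A} {x} (x∈xs : x ∈ xs) →
    _≡_ {A = Σ A (_∈ xs)} (lookup xs (index x∈xs) , ∈-lookup (index x∈xs)) (x , x∈xs)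
  ∈-lookup-index (here refl) = refl
  ∈-lookup-index (there x∈xs) = cong (λ (y , y∈xs) → y , there y∈xs) (∈-lookup-index x∈xs)

  Fin-length↔∈ : (xs : List A) → Fin (length xs) ↔ Σ A (_∈ xs)
  Fin-length↔∈ xs = mk↔ₛ′ (λ i → lookup xs i , ∈-lookup i) (λ (_ , x∈xs) → index x∈xs)
    (λ (_ , x∈xs) → ∈-lookup-index x∈xs) (index-∈-lookup xs)

module _ {c ℓ} (M : CommutativeMonoid c ℓ) where
  open CommutativeMonoid M using (Carrier; _∙_; ε; _≈_; setoid; reflexive)
    renaming (trans to ≈-trans)
  open CommutativeMonoidSum M using (sum; sum-cong-≋; sum-permute)
  open import Relation.Binary.Reasoning.Setoid setoid

  foldr-map≡sum-lookup : ∀ {a} {A : Set a} (xs : List A) (g : A → Carrier) →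
    foldr _∙_ ε (map g xs) ≡ sum (λ i → g (lookup xs i))
  foldr-map≡sum-lookup []       g = refl
  foldr-map≡sum-lookup (x ∷ xs) g = cong (g x ∙_) (foldr-map≡sum-lookup xs g)

  foldr-map-cong-⤖ : ∀ {a b} {A : Set a} {B : Set b} (xs : List A) (ys : List B)
    (g : A → Carrier) (g′ : B → Carrier) (φ : Σ A (_∈ xs) ⤖ Σ B (_∈ ys)) →
    (∀ m → g (proj₁ m) ≈ g′ (proj₁ (Bijection.to φ m))) →
    foldr _∙_ ε (map g xs) ≈ foldr _∙_ ε (map g′ ys)
  foldr-map-cong-⤖ {A = A} xs ys g g′ φ g≈g′∘φ = begin
    foldr _∙_ ε (map g xs)                  ≡⟨ foldr-map≡sum-lookup xs g ⟩
    sum (λ i → g (lookup xs i))             ≈⟨ sum-cong-≋ g≈g′∘π ⟩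
    sum (λ i → g′ (lookup ys (π ⟨$⟩ʳ i)))   ≈⟨ sum-permute (λ j → g′ (lookup ys j)) π ⟨
    sum (λ j → g′ (lookup ys j))            ≡⟨ foldr-map≡sum-lookup ys g′ ⟨
    foldr _∙_ ε (map g′ ys)                 ∎
    where
    π : Fin (length xs) ↔ Fin (length ys)
    π = ↔-sym (Fin-length↔∈ ys) ↔-∘ (⤖⇒↔ φ ↔-∘ Fin-length↔∈ xs)
    g≈g′∘π : ∀ i → g (lookup xs i) ≈ g′ (lookup ys (π ⟨$⟩ʳ i))
    g≈g′∘π i = ≈-trans (g≈g′∘φ xᵢ) (reflexive (cong (g′ ∘′ proj₁) (sym (∈-lookup-index (proj₂ (Bijection.to φ xᵢ))))))
      where
      xᵢ : Σ A (_∈ xs)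
      xᵢ = lookup xs i , ∈-lookup i

all-or-any : ∀ {a p q} {A : Set a} {P : A → Set p} {Q : A → Set q} (xs : List A) →
  (∀ {x} → x ∈ xs → P x ⊎ Q x) → All P xs ⊎ Any Q xs
all-or-any []       _     = inj₁ []
all-or-any (x ∷ xs) P⊎Q with P⊎Q (here refl) | all-or-any xs (P⊎Q ∘′ there)
... | inj₂ qx | _         = inj₂ (here qx)
... | inj₁ _  | inj₂ qxs  = inj₂ (there qxs)
... | inj₁ px | inj₁ pxs  = inj₁ (px ∷ pxs)

module _ {n} (succ : Fin n → List (Fin n)) where

  _⟶_ : Fin n → Fin n → Set
  v ⟶ w = w ∈ succ v

  WalkFrom : ℕ → Fin n → Set
  WalkFrom k v = Σ (ℕ → Fin n) λ p → p 0 ≡ v × (∀ i → i < k → p i ⟶ p (suc i))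

  walk-cons : ∀ {k v w} → v ⟶ w → WalkFrom k w → WalkFrom (suc k) v
  walk-cons {v = v} v⟶w (p , refl , p-steps) = p′ , refl , p′-steps
    where
    p′ : ℕ → Fin n
    p′ zero    = v
    p′ (suc i) = p i
    p′-steps : ∀ i → i < suc _ → p′ i ⟶ p′ (suc i)
    p′-steps zero    _           = v⟶w
    p′-steps (suc i) (s≤s i<k)   = p-steps i i<k

  acc-or-walk : ∀ k v → Acc (flip _⟶_) v ⊎ WalkFrom k v
  acc-or-walk zero    v = inj₂ ((λ _ → v) , refl , λ _ ())
  acc-or-walk (suc k) v with all-or-any (succ v) (λ {w} _ → acc-or-walk k w)
  ... | inj₁ succ-acc  = inj₁ (acc (All.lookup succ-acc))
  ... | inj₂ succ-walk with w , v⟶w , walk ← find succ-walk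
      = inj₂ (walk-cons v⟶w walk)

  walk-segment : ∀ {k} (p : ℕ → Fin n) → (∀ i → i < k → p i ⟶ p (suc i)) →
    ∀ {i j} → i < j → j ≤ k → TransClosure _⟶_ (p i) (p j)
  walk-segment p steps {i} {suc j} i<1+j 1+j≤k with m<1+n⇒m<n∨m≡n i<1+j
  ... | inj₁ i<j  = walk-segment p steps i<j (<⇒≤ 1+j≤k) ∷ʳ steps j 1+j≤k
  ... | inj₂ refl = [ steps i 1+j≤k ]

  module _ (acyclic : ∀ v → ¬ TransClosure _⟶_ v v) where

    no-walk-of-length-n : ∀ {v} → ¬ WalkFrom n v
    no-walk-of-length-n (p , _ , steps)
      with i , j , i<j , pᵢ≡pⱼ ← pigeonhole (n<1+n n) (λ (i : Fin (suc n)) → p (toℕ i))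
      = acyclic (p (toℕ i))
          (subst (TransClosure _⟶_ (p (toℕ i))) (sym pᵢ≡pⱼ) (walk-segment p steps i<j (toℕ≤pred[n] j)))

    acyclic⇒wellFounded : WellFounded (flip _⟶_)
    acyclic⇒wellFounded v with acc-or-walk n v
    ... | inj₁ acc-v = acc-v
    ... | inj₂ walk  = ⊥-elim (no-walk-of-length-n walk)

player-cases : ∀ σ ρ → ρ ≡ σ ⊎ ρ ≡ opp σ
player-cases P0 P0 = inj₁ refl
player-cases P0 P1 = inj₂ refl
player-cases P1 P0 = inj₂ refl
player-cases P1 P1 = inj₁ refl

bisimilar-kinds : ∀ {z} {G G′ : GameGraph} {Z : V G → V G′ → Set z} →
  IsCountingBisimulation G G′ Z → ∀ {v v′} → Z v v′ → kind G v ≡ kind G′ v′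
bisimilar-kinds {G = G} bisim {v} {v′} zv with kind G v in kv
... | terminal = sym (proj₁ (proj₂ (bisim v v′ zv)) kv)
... | player ρ = sym (proj₁ (proj₁ (bisim v v′ zv) ρ) kv)

module _ {c ℓ z} (K : CommutativeSemiring c ℓ) (σ : Player) (G G′ : GameGraph)
  {f h f′ h′} {Z : V G → V G′ → Set z}
  (bisim : IsCountingBisimulation G G′ Z) (respects : RespectsValuations K G G′ Z f h f′ h′)
  {F F′} (induced : IsInducedValuation K σ G f h F) (induced′ : IsInducedValuation K σ G′ f′ h′ F′)
  where
  open CommutativeSemiring K
    using (_≈_; _*_; *-cong; setoid; +-commutativeMonoid; *-commutativeMonoid)
  open import Relation.Binary.Reasoning.Setoid setoid

  bisimilar-valuations-agree : ∀ {v} → Acc (flip (Edge G)) v → ∀ {v′} → Z v v′ → F v ≈ F′ v′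
  bisimilar-valuations-agree {v} (acc rec) {v′} zv
    with kind G v in kv | kind G′ v′ in kv′ | bisimilar-kinds {G = G} {G′} bisim zv | bisim v v′ zv
  ... | terminal | terminal | refl | _ = begin
    F v    ≈⟨ proj₁ (induced v) kv ⟩
    f v    ≈⟨ proj₁ respects v v′ zv kv kv′ ⟩
    f′ v′  ≈⟨ proj₁ (induced′ v′) kv′ ⟨
    F′ v′  ∎
  ... | player ρ | player ρ | refl | _ , _ , _ , succ-bij , succ-Z = by-owner (player-cases σ ρ)
    where
    summands-agree : ∀ ((w , v⟶w) : vE G v) →
      let (w′ , v′⟶w′) = Bijection.to succ-bij (w , v⟶w) in h v w * F w ≈ h′ v′ w′ * F′ w′
    summands-agree (w , v⟶w) =
      *-cong (proj₂ respects v v′ w _ zv (succ-Z (w , v⟶w)) v⟶w (proj₂ (Bijection.to succ-bij (w , v⟶w))))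
             (bisimilar-valuations-agree (rec v⟶w) (succ-Z (w , v⟶w)))

    by-owner : ρ ≡ σ ⊎ ρ ≡ opp σ → F v ≈ F′ v′
    by-owner (inj₁ refl) = begin
      F v                                            ≈⟨ proj₁ (proj₂ (induced v)) kv ⟩
      ΣK K (map (λ w → h v w * F w) (succ G v))      ≈⟨ foldr-map-cong-⤖ +-commutativeMonoid
                                                          (succ G v) (succ G′ v′) _ _ succ-bij summands-agree ⟩
      ΣK K (map (λ w → h′ v′ w * F′ w) (succ G′ v′)) ≈⟨ proj₁ (proj₂ (induced′ v′)) kv′ ⟨
      F′ v′                                          ∎
    by-owner (inj₂ refl) = begin
      F v                                            ≈⟨ proj₂ (proj₂ (induced v)) kv ⟩
      ΠK K (map (λ w → h v w * F w) (succ G v))      ≈⟨ foldr-map-cong-⤖ *-commutativeMonoid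
                                                          (succ G v) (succ G′ v′) _ _ succ-bij summands-agree ⟩
      ΠK K (map (λ w → h′ v′ w * F′ w) (succ G′ v′)) ≈⟨ proj₂ (proj₂ (induced′ v′)) kv′ ⟨
      F′ v′                                          ∎

mainTheorem8 : ∀ {c ℓ z} (K : CommutativeSemiring c ℓ) (σ : Player)
    (G G' : GameGraph) → Acyclic G → Acyclic G' →
    (f : V G → CommutativeSemiring.Carrier K) (h : V G → V G → CommutativeSemiring.Carrier K) →
    (f' : V G' → CommutativeSemiring.Carrier K) (h' : V G' → V G' → CommutativeSemiring.Carrier K) →
    NonzeroOnEdges K G h → NonzeroOnEdges K G' h' →
    (Z : V G → V G' → Set z) → IsCountingBisimulation G G' Z →
    RespectsValuations K G G' Z f h f' h' →
    (F : V G → CommutativeSemiring.Carrier K) (F' : V G' → CommutativeSemiring.Carrier K) →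
    IsInducedValuation K σ G f h F → IsInducedValuation K σ G' f' h' F' →
    ∀ v v' → Z v v' → CommutativeSemiring._≈_ K (F v) (F' v')
mainTheorem8 K σ G G' acyclic _ _ _ _ _ _ _ _ bisim respects _ _ induced induced' v v' =
  bisimilar-valuations-agree K σ G G' bisim respects induced induced'
    (acyclic⇒wellFounded (succ G) acyclic v)
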